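{- Let $i\ge0$ be an integer. If $G$ is an $\alpha_i$-metric graph, then its interval thinness is at most $i+1$; that is, for all vertices $u,v,x,y$ with $x,y\in I(u,v)$ and $d(u,x)=d(u,y)$, we have $d(x,y)\le i+1$.
   Context: All graphs are finite, connected, unweighted, undirected, simple; $d(u,v)$ is the shortest-path distance. $I(u,v)=\{x: d(u,x)+d(x,v)=d(u,v)\}$. A graph is $\alpha_i$-metric if for all vertices $u,w,v,x$: whenever $v\in I(u,w)$, $w\in I(v,x)$ and $vw$ is an edge, then $d(u,x)\ge d(u,v)+d(v,x)-i$. -}

module Defs where

open import Data.Nat using (ℕ; zero; suc; _+_; _≤_)
open import Data.Fin using (Fin)
open import Data.Product using (∃)
open import Relation.Binary.PropositionalEquality using (_≡_)
open import Relation.Nullary using (¬_)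

data Walk {n : ℕ} (Adj : Fin n → Fin n → Set) : Fin n → Fin n → ℕ → Set where
  [] : ∀ {u} → Walk Adj u u zero
  _∷_ : ∀ {u w v k} → Adj u w → Walk Adj w v k → Walk Adj u v (suc k)

record Graph : Set₁ where
  field
    n         : ℕ
    Adj       : Fin n → Fin n → Set
    sym       : ∀ {u v} → Adj u v → Adj v u
    irrefl    : ∀ {u} → ¬ Adj u u
    connected : ∀ u v → ∃ λ k → Walk Adj u v k

  V : Set
  V = Fin n

open Graph public

-- d is the shortest-path distance of G: d u v is the length of some walk
-- from u to v, and every walk from u to v has length at least d u v.
-- (This characterises d uniquely, since G is connected.)
record IsDistance (G : Graph) (d : V G → V G → ℕ) : Set where
  field
    realised : ∀ u v → Walk (Adj G) u v (d u v)
    minimal  : ∀ u v k → Walk (Adj G) u v k → d u v ≤ k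

InInterval : {G : Graph} → (V G → V G → ℕ) → V G → V G → V G → Set
InInterval d x u v = d u x + d x v ≡ d u v

-- α_i-metric: v ∈ I(u,w), w ∈ I(v,x), vw ∈ E  ⇒  d(u,x) ≥ d(u,v) + d(v,x) - i
-- (stated without truncated subtraction as d(u,v)+d(v,x) ≤ d(u,x)+i)
IsAlphaMetric : (G : Graph) → (V G → V G → ℕ) → ℕ → Set
IsAlphaMetric G d i =
  ∀ u w v x → InInterval {G} d v u w → InInterval {G} d w v x → Adj G v w →
  d u v + d v x ≤ d u x + i

-- Induct on the common level k = d(u,x) = d(u,y). A vertex b of I(u,v) at level k+1 has a
-- neighbour b' one step closer to u and still in I(u,v). For any a at level at most one above b
-- (w.r.t. both u and v), the α_i condition applied along the edge bb' shows that either
-- d(a,b) ≤ i+1 or d(a,b) = d(a,b'). Applying this once to replace x by x' and once to replace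
-- y by y' reduces the problem to the pair x', y' at level k.
module Submission where

open import Defs
open import Data.Nat using (ℕ; zero; suc; _+_; _≤_; z≤n; s≤s)
open import Data.Nat.Properties
open import Data.Fin using (Fin)
open import Data.Product using (∃; _×_; _,_; proj₁; proj₂)
open import Data.Sum using (_⊎_; inj₁; inj₂)
open import Relation.Binary.Definitions using (tri<; tri≈; tri>)
open import Relation.Binary.PropositionalEquality
  using (_≡_; _≢_; refl; cong; cong₂; subst; subst₂; module ≡-Reasoning)
  renaming (sym to ≡-sym; trans to ≡-trans)

module _ {n : ℕ} {A : Fin n → Fin n → Set} where

  _++_ : ∀ {a b c k l} → Walk A a b k → Walk A b c l → Walk A a c (k + l)
  []      ++ q = q
  (e ∷ p) ++ q = e ∷ (p ++ q)

  _∷ʳ_ : ∀ {a b c k} → Walk A a b k → A b c → Walk A a c (suc k)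
  []      ∷ʳ e′ = e′ ∷ []
  (e ∷ p) ∷ʳ e′ = e ∷ (p ∷ʳ e′)

  reverse : (∀ {a b} → A a b → A b a) → ∀ {a b k} → Walk A a b k → Walk A b a k
  reverse s []      = []
  reverse s (e ∷ p) = reverse s p ∷ʳ s e

  empty-walk⇒≡ : ∀ {a b} → Walk A a b zero → a ≡ b
  empty-walk⇒≡ [] = refl

  uncons : ∀ {a b k} → Walk A a b (suc k) → ∃ λ c → A a c × Walk A c b k
  uncons (e ∷ p) = _ , e , p

m+n≤o+i∧o≤1+n⇒m≤1+i : ∀ {m n o i} → m + n ≤ o + i → o ≤ suc n → m ≤ suc i
m+n≤o+i∧o≤1+n⇒m≤1+i {m} {n} {o} {i} m+n≤o+i o≤1+n = +-cancelʳ-≤ n m (suc i) (begin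
  m + n         ≤⟨ m+n≤o+i ⟩
  o + i         ≤⟨ +-monoˡ-≤ i o≤1+n ⟩
  suc (n + i)   ≡⟨ cong suc (+-comm n i) ⟩
  suc i + n     ∎)
  where open ≤-Reasoning

module Distance {G : Graph} {d : V G → V G → ℕ} (isD : IsDistance G d) where
  open IsDistance isD

  triangle : ∀ a b c → d a c ≤ d a b + d b c
  triangle a b c = minimal a c _ (realised a b ++ realised b c)

  d-sym : ∀ a b → d a b ≡ d b a
  d-sym a b = ≤-antisym (minimal a b _ (reverse (Graph.sym G) (realised b a)))
                        (minimal b a _ (reverse (Graph.sym G) (realised a b)))

  adj⇒d≡1 : ∀ {a b} → Adj G a b → d a b ≡ 1
  adj⇒d≡1 {a} {b} e = ≤-antisym (minimal a b 1 (e ∷ [])) (n≢0⇒n>0 d≢0)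
    where
      d≢0 : d a b ≢ 0
      d≢0 d≡0 = irrefl G (subst (λ c → Adj G c b)
                  (empty-walk⇒≡ (subst (Walk (Adj G) a b) d≡0 (realised a b))) e)

  adj⇒d≤suc : ∀ {b c} → Adj G b c → ∀ a → d a c ≤ suc (d a b)
  adj⇒d≤suc {b} {c} e a = subst (d a c ≤_) (≡-trans (cong (d a b +_) (adj⇒d≡1 e)) (+-comm (d a b) 1))
                                (triangle a b c)

  record Descent (u v b : V G) : Set where
    field
      next    : V G
      adj     : Adj G b next
      closer  : suc (d u next) ≡ d u b
      farther : d next v ≡ suc (d b v)

  open Descent public

  descent : ∀ {u v b k} → InInterval {G} d b u v → d u b ≡ suc k → Descent u v b
  descent {u} {v} {b} {k} b∈I db≡ = record
    { next = c ; adj = e ; closer = closer′ ; farther = farther′ }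
    where
      split = uncons (subst (Walk (Adj G) b u) (≡-trans (d-sym b u) db≡) (realised b u))
      c = proj₁ split
      e = proj₁ (proj₂ split)
      dcu≤k : d u c ≤ k
      dcu≤k = subst (_≤ k) (d-sym c u) (minimal c u k (proj₂ (proj₂ split)))
      closer′ : suc (d u c) ≡ d u b
      closer′ = ≤-antisym (subst (suc (d u c) ≤_) (≡-sym db≡) (s≤s dcu≤k))
                          (adj⇒d≤suc (Graph.sym G e) u)
      farther′ : d c v ≡ suc (d b v)
      farther′ = ≤-antisym
        (subst (λ t → d c v ≤ t + d b v) (adj⇒d≡1 (Graph.sym G e)) (triangle c b v))
        (+-cancelˡ-≤ (d u c) _ _ (begin
          d u c + suc (d b v)   ≡⟨ +-suc (d u c) (d b v) ⟩
          suc (d u c) + d b v   ≡⟨ cong (_+ d b v) closer′ ⟩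
          d u b + d b v         ≡⟨ b∈I ⟩
          d u v                 ≤⟨ triangle u c v ⟩
          d u c + d c v         ∎))
        where open ≤-Reasoning

  descent-∈I : ∀ {u v b} (D : Descent u v b) → InInterval {G} d b u v → InInterval {G} d (next D) u v
  descent-∈I {u} {v} {b} D b∈I = begin
    d u (next D) + d (next D) v     ≡⟨ cong (d u (next D) +_) (farther D) ⟩
    d u (next D) + suc (d b v)      ≡⟨ +-suc (d u (next D)) (d b v) ⟩
    suc (d u (next D)) + d b v      ≡⟨ cong (_+ d b v) (closer D) ⟩
    d u b + d b v                   ≡⟨ b∈I ⟩
    d u v                           ∎
    where open ≡-Reasoning

  -- The two strict cases are the two ways the edge b b′ can extend a geodesic from a:
  -- towards u (via b′) or towards v (via b).
  descent-step : ∀ {i} → IsAlphaMetric G d i → ∀ {u v b} (D : Descent u v b) a →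
                 d u a ≤ suc (d u b) → d a v ≤ suc (d b v) →
                 d a b ≤ suc i ⊎ d a b ≡ d a (next D)
  descent-step {i} α {u} {v} {b} D a au≤ av≤ with <-cmp (d a b) (d a (next D))
  ... | tri≈ _ eq _ = inj₂ eq
  ... | tri< lt _ _ = inj₁ (m+n≤o+i∧o≤1+n⇒m≤1+i (α a c b u b∈Iac c∈Ibu (adj D)) a-level)
    where
      c = next D
      dbc≡1 : d b c ≡ 1
      dbc≡1 = adj⇒d≡1 (adj D)
      b∈Iac : d a b + d b c ≡ d a c
      b∈Iac = begin
        d a b + d b c   ≡⟨ cong (d a b +_) dbc≡1 ⟩
        d a b + 1       ≡⟨ +-comm (d a b) 1 ⟩
        suc (d a b)     ≡⟨ ≤-antisym lt (adj⇒d≤suc (adj D) a) ⟩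
        d a c           ∎
        where open ≡-Reasoning
      c∈Ibu : d b c + d c u ≡ d b u
      c∈Ibu = begin
        d b c + d c u   ≡⟨ cong₂ _+_ dbc≡1 (d-sym c u) ⟩
        suc (d u c)     ≡⟨ closer D ⟩
        d u b           ≡⟨ d-sym u b ⟩
        d b u           ∎
        where open ≡-Reasoning
      a-level : d a u ≤ suc (d b u)
      a-level = subst₂ (λ s t → s ≤ suc t) (d-sym u a) (d-sym u b) au≤
  ... | tri> _ _ gt = inj₁ (m+n≤o+i∧o≤1+n⇒m≤1+i (subst (_≤ d a v + i) c-to-b
                              (α a b c v c∈Iab b∈Icv (Graph.sym G (adj D)))) av≤)
    where
      c = next D
      dcb≡1 : d c b ≡ 1
      dcb≡1 = adj⇒d≡1 (Graph.sym G (adj D))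
      dab≡ : d a b ≡ suc (d a c)
      dab≡ = ≤-antisym (adj⇒d≤suc (Graph.sym G (adj D)) a) gt
      c∈Iab : d a c + d c b ≡ d a b
      c∈Iab = begin
        d a c + d c b   ≡⟨ cong (d a c +_) dcb≡1 ⟩
        d a c + 1       ≡⟨ +-comm (d a c) 1 ⟩
        suc (d a c)     ≡⟨ dab≡ ⟨
        d a b           ∎
        where open ≡-Reasoning
      b∈Icv : d c b + d b v ≡ d c v
      b∈Icv = ≡-trans (cong (_+ d b v) dcb≡1) (≡-sym (farther D))
      c-to-b : d a c + d c v ≡ d a b + d b v
      c-to-b = begin
        d a c + d c v         ≡⟨ cong (d a c +_) (farther D) ⟩
        d a c + suc (d b v)   ≡⟨ +-suc (d a c) (d b v) ⟩
        suc (d a c) + d b v   ≡⟨ cong (_+ d b v) dab≡ ⟨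
        d a b + d b v         ∎
        where open ≡-Reasoning

  descent-pair : ∀ {i} → IsAlphaMetric G d i → ∀ {u v x y} (Dx : Descent u v x) (Dy : Descent u v y) →
                 d u x ≡ d u y → d x v ≡ d y v → d (next Dx) (next Dy) ≤ suc i → d x y ≤ suc i
  descent-pair {i} α {u} {v} {x} {y} Dx Dy ux≡uy xv≡yv x′y′≤
    with descent-step α Dx y (≤-trans (≤-reflexive (≡-sym ux≡uy)) (n≤1+n _))
                             (≤-trans (≤-reflexive (≡-sym xv≡yv)) (n≤1+n _))
       | descent-step α Dy (next Dx) x′-level (≤-reflexive (≡-trans (farther Dx) (cong suc xv≡yv)))
    where
      x′-level : d u (next Dx) ≤ suc (d u y)
      x′-level = ≤-trans (n≤1+n _) (≤-trans (≤-reflexive (≡-trans (closer Dx) ux≡uy)) (n≤1+n _))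
  ... | inj₁ yx≤ | _ = subst (_≤ suc i) (d-sym y x) yx≤
  ... | inj₂ yx≡yx′ | inj₁ x′y≤ = subst (_≤ suc i) (≡-sym (begin
    d x y          ≡⟨ d-sym x y ⟩
    d y x          ≡⟨ yx≡yx′ ⟩
    d y (next Dx)  ≡⟨ d-sym y (next Dx) ⟩
    d (next Dx) y  ∎)) x′y≤
    where open ≡-Reasoning
  ... | inj₂ yx≡yx′ | inj₂ x′y≡x′y′ = subst (_≤ suc i) (≡-sym (begin
    d x y                  ≡⟨ d-sym x y ⟩
    d y x                  ≡⟨ yx≡yx′ ⟩
    d y (next Dx)          ≡⟨ d-sym y (next Dx) ⟩
    d (next Dx) y          ≡⟨ x′y≡x′y′ ⟩
    d (next Dx) (next Dy)  ∎)) x′y′≤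
    where open ≡-Reasoning

  interval-thin : ∀ {i} → IsAlphaMetric G d i → ∀ {u v} k x y → d u x ≡ k → d u y ≡ k →
                  InInterval {G} d x u v → InInterval {G} d y u v → d x y ≤ suc i
  interval-thin {i} α {u} zero x y ux≡0 uy≡0 _ _ = begin
    d x y           ≤⟨ triangle x u y ⟩
    d x u + d u y   ≡⟨ cong₂ _+_ (≡-trans (d-sym x u) ux≡0) uy≡0 ⟩
    0               ≤⟨ z≤n ⟩
    suc i           ∎
    where open ≤-Reasoning
  interval-thin α {u} {v} (suc k) x y ux≡ uy≡ x∈I y∈I =
    descent-pair α Dx Dy (≡-trans ux≡ (≡-sym uy≡)) xv≡yv
      (interval-thin α k (next Dx) (next Dy) (level Dx ux≡) (level Dy uy≡)
        (descent-∈I Dx x∈I) (descent-∈I Dy y∈I))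
    where
      Dx = descent x∈I ux≡
      Dy = descent y∈I uy≡
      level : ∀ {b} (D : Descent u v b) → d u b ≡ suc k → d u (next D) ≡ k
      level D ub≡ = suc-injective (≡-trans (closer D) ub≡)
      xv≡yv : d x v ≡ d y v
      xv≡yv = +-cancelˡ-≡ (suc k) _ _ (begin
        suc k + d x v   ≡⟨ cong (_+ d x v) ux≡ ⟨
        d u x + d x v   ≡⟨ ≡-trans x∈I (≡-sym y∈I) ⟩
        d u y + d y v   ≡⟨ cong (_+ d y v) uy≡ ⟩
        suc k + d y v   ∎)
        where open ≡-Reasoning

lemma2 : (i : ℕ) (G : Graph) (d : V G → V G → ℕ) → IsDistance G d →
         IsAlphaMetric G d i →
         ∀ u v x y → InInterval {G} d x u v → InInterval {G} d y u v →
         d u x ≡ d u y → d x y ≤ suc i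
lemma2 i G d isD α u v x y x∈I y∈I ux≡uy =
  Distance.interval-thin isD α (d u x) x y refl (≡-sym ux≡uy) x∈I y∈I
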